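{- Fix any integer $n \ge 2$. For every $\varepsilon > 0$ there is no constant $C > 0$ such that $$F(\boldsymbol{a}) \le C \cdot (a_1 a_n)^{1-\varepsilon}$$ holds for all vectors $\boldsymbol{a} = (a_1,\ldots,a_n)^T \in \mathbb{Z}^n_{>0}$ with $\gcd(a_1,\ldots,a_n) = 1$ and $a_1 \le a_2 \le \cdots \le a_n$.
   Context: For $\boldsymbol{a} = (a_1,\ldots,a_n)^T \in \mathbb{Z}^n_{>0}$ with $n\ge 2$ and $\gcd(a_1,\ldots,a_n)=1$, the Frobenius number is $F(\boldsymbol{a}) := \max\{ b \in \mathbb{Z} : b \neq \boldsymbol{a}^T \boldsymbol{z} \text{ for all } \boldsymbol{z} \in \mathbb{Z}^n_{\ge 0}\}$, the largest integer not representable as a nonnegative integer combination of $a_1,\ldots,a_n$.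
   Formalization: The parameters ε and C range over the positive rationals. -}

module Defs where

open import Data.Nat as ℕ using (ℕ; zero; suc; _+_; _*_)
open import Data.Nat.GCD using (gcd)
open import Data.Integer as ℤ using (ℤ; +_; -[1+_])
open import Data.Rational as ℚ using (ℚ; 0ℚ; 1ℚ; _≤_)
open import Data.Fin using (Fin)
open import Data.Vec.Functional using (foldr)
open import Data.Product using (∃; _×_)
open import Data.Sum using (_⊎_)
open import Relation.Nullary using (¬_)
open import Relation.Binary.PropositionalEquality using (_≡_)

gcdᵛ : ∀ {n} → (Fin n → ℕ) → ℕ
gcdᵛ a = foldr gcd 0 a

Representable : ∀ {n} → (Fin n → ℕ) → ℤ → Set
Representable a b = ∃ λ (z : Fin _ → ℕ) → b ≡ + foldr _+_ 0 (λ i → a i * z i)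

IsFrobenius : ∀ {n} → (Fin n → ℕ) → ℤ → Set
IsFrobenius a f = ¬ Representable a f × (∀ (b : ℤ) → f ℤ.< b → Representable a b)

_^ℚ_ : ℚ → ℕ → ℚ
q ^ℚ zero = 1ℚ
q ^ℚ suc k = q ℚ.* (q ^ℚ k)

posPart negPart : ℤ → ℕ
posPart (+ k) = k
posPart -[1+ k ] = 0
negPart (+ k) = 0
negPart -[1+ k ] = suc k

-- "y ≤ C · x^s" for a rational exponent s = p/d (d ≥ 1, lowest terms),
-- intended for x > 0 and C > 0, where x^s is the positive real d-th root of x^p.
-- Either y ≤ 0 (then it holds since C · x^s > 0), or y > 0 and both sides are
-- positive so it is equivalent to y^d ≤ C^d · x^p, written without division as
-- y^d · x^{p⁻} ≤ C^d · x^{p⁺}.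
LeCPow : ℚ → ℚ → ℚ → ℚ → Set
LeCPow y C x s =
  y ≤ 0ℚ ⊎ ((y ^ℚ d) ℚ.* (x ^ℚ negPart p) ≤ (C ^ℚ d) ℚ.* (x ^ℚ posPart p))
  where
  d = ℚ.denominatorℕ s
  p = ℚ.numerator s

-- For odd b ≥ 3 the vector (2, b, …, b) has Frobenius number b − 2: a combination
-- using b at all is at least b, one without b is even, and above b − 2 every even
-- number is a multiple of 2 and every odd one is b plus a multiple of 2.
-- So F(a) = b − 2 while a₁aₙ = 2b, and F(a) ≤ C (2b)^s with s = p/d < 1 fails for
-- large b: with an integer c ≥ C it amounts to c^d (2b)^p < (b − 2)^d, which holds
-- once b − 2 > (3c)^d because then 2b ≤ 3(b − 2).
module Submission where

open import Defs
open import Data.Nat using (ℕ; suc; _*_; _≤_; _<_)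
open import Data.Integer using (ℤ; +_)
open import Data.Rational using (ℚ; 0ℚ; 1ℚ; _-_; _/_) renaming (_<_ to _<ℚ_)
open import Data.Fin using (Fin; zero; fromℕ) renaming (_≤_ to _≤ᶠ_)
open import Relation.Nullary using (¬_)
open import Relation.Binary.PropositionalEquality using (_≡_)

open import Data.Nat using (zero; _+_; _^_; z≤n; s≤s; z<s; NonZero; >-nonZero)
import Data.Nat.Properties as ℕP
open import Data.Nat.Solver using (module +-*-Solver)
open +-*-Solver using (solve; _:+_; _:*_; _:=_; con)
open import Data.Nat.Divisibility using (_∣_; ∣1⇒≡1; ∣m+n∣m⇒∣n; ∣-trans; m∣m*n)
open import Data.Nat.GCD using (gcd[m,n]∣m; gcd[m,n]∣n)
open import Data.Nat.Coprimality as Coprime using (1-coprimeTo)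
import Data.Integer as ℤ
import Data.Integer.Properties as ℤP
open import Data.Rational using (mkℚ)
import Data.Rational as ℚ
import Data.Rational.Properties as ℚP
import Data.Fin as Fin
open import Data.Vec.Functional using (foldr)
open import Data.Product using (_,_; ∃)
open import Data.Sum using (_⊎_; inj₁; inj₂; [_,_])
open import Function using (_∘_)
open import Relation.Binary.PropositionalEquality
  using (_≢_; refl; sym; trans; cong; cong₂; subst; subst₂; module ≡-Reasoning)

sumᵛ : ∀ {n} → (Fin n → ℕ) → ℕ
sumᵛ = foldr _+_ 0

sumᵛ-*ˡ : ∀ {n} b (w : Fin n → ℕ) → sumᵛ (λ i → b * w i) ≡ b * sumᵛ w
sumᵛ-*ˡ {zero}  b w = sym (ℕP.*-zeroʳ b)
sumᵛ-*ˡ {suc n} b w = begin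
  b * w zero + sumᵛ (λ i → b * w (Fin.suc i)) ≡⟨ cong (λ t → b * w zero + t) (sumᵛ-*ˡ b (w ∘ Fin.suc)) ⟩
  b * w zero + b * sumᵛ (w ∘ Fin.suc)         ≡⟨ ℕP.*-distribˡ-+ b (w zero) _ ⟨
  b * sumᵛ w                                  ∎
  where open ≡-Reasoning

sumᵛ-zeros : ∀ n → sumᵛ {n} (λ _ → 0) ≡ 0
sumᵛ-zeros zero    = refl
sumᵛ-zeros (suc n) = sumᵛ-zeros n

gcdᵛ∣ : ∀ {n} (a : Fin n → ℕ) i → gcdᵛ a ∣ a i
gcdᵛ∣ a zero        = gcd[m,n]∣m (a zero) _
gcdᵛ∣ a (Fin.suc i) = ∣-trans (gcd[m,n]∣n (a zero) _) (gcdᵛ∣ (a ∘ Fin.suc) i)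

even⊎odd : ∀ n → ∃ λ q → n ≡ 2 * q ⊎ n ≡ suc (2 * q)
even⊎odd zero = 0 , inj₁ refl
even⊎odd (suc n) with even⊎odd n
... | q , inj₁ refl = q , inj₂ refl
... | q , inj₂ refl = suc q , inj₁ (solve 1 (λ q → con 2 :+ con 2 :* q := con 2 :* (con 1 :+ q)) refl q)

^-distribʳ-* : ∀ m n k → (m * n) ^ k ≡ m ^ k * n ^ k
^-distribʳ-* m n zero    = refl
^-distribʳ-* m n (suc k) = begin
  m * n * (m * n) ^ k       ≡⟨ cong (m * n *_) (^-distribʳ-* m n k) ⟩
  m * n * (m ^ k * n ^ k)   ≡⟨ solve 4 (λ m n a b → m :* n :* (a :* b) := m :* a :* (n :* b)) refl m n (m ^ k) (n ^ k) ⟩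
  m * m ^ k * (n * n ^ k)   ∎
  where open ≡-Reasoning

twoAnd : ∀ {n} → ℕ → Fin (suc n) → ℕ
twoAnd b zero        = 2
twoAnd b (Fin.suc _) = b

twoAnd-pos : ∀ {n b} → 0 < b → ∀ i → 0 < twoAnd {n} b i
twoAnd-pos 0<b zero        = z<s
twoAnd-pos 0<b (Fin.suc i) = 0<b

twoAnd-mono : ∀ {n b} → 2 ≤ b → ∀ (i j : Fin (suc n)) → i ≤ᶠ j → twoAnd {n} b i ≤ twoAnd b j
twoAnd-mono 2≤b zero        zero        _  = ℕP.≤-refl
twoAnd-mono 2≤b zero        (Fin.suc j) _  = 2≤b
twoAnd-mono 2≤b (Fin.suc i) (Fin.suc j) _  = ℕP.≤-refl

twoAnd-gcd : ∀ {n} m → gcdᵛ (twoAnd {suc n} (3 + 2 * m)) ≡ 1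
twoAnd-gcd {n} m = ∣1⇒≡1 (∣m+n∣m⇒∣n G∣b G∣2[1+m])
  where
  a = twoAnd {suc n} (3 + 2 * m)
  G∣b : gcdᵛ a ∣ 2 * suc m + 1
  G∣b = subst (gcdᵛ a ∣_) (solve 1 (λ m → con 3 :+ con 2 :* m := con 2 :* (con 1 :+ m) :+ con 1) refl m)
              (gcdᵛ∣ a (Fin.suc zero))
  G∣2[1+m] : gcdᵛ a ∣ 2 * suc m
  G∣2[1+m] = ∣-trans (gcdᵛ∣ a zero) (m∣m*n (suc m))

twoAnd-combination : ∀ {n} b (z : Fin (suc n) → ℕ) →
  sumᵛ (λ i → twoAnd b i * z i) ≡ 2 * z zero + b * sumᵛ (z ∘ Fin.suc)
twoAnd-combination b z = cong (λ t → 2 * z zero + t) (sumᵛ-*ˡ b (z ∘ Fin.suc))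

twoAnd-representable : ∀ {n} b u v c → 2 * u + b * v ≡ c → Representable (twoAnd {suc n} b) (+ c)
twoAnd-representable {n} b u v c eq = z , cong +_ (sym (begin
  sumᵛ (λ i → twoAnd b i * z i)          ≡⟨ twoAnd-combination b z ⟩
  2 * u + b * (v + sumᵛ {n} (λ _ → 0))   ≡⟨ cong (λ w → 2 * u + b * (v + w)) (sumᵛ-zeros n) ⟩
  2 * u + b * (v + 0)                    ≡⟨ cong (λ w → 2 * u + b * w) (ℕP.+-identityʳ v) ⟩
  2 * u + b * v                          ≡⟨ eq ⟩
  c                                      ∎))
  where
  open ≡-Reasoning
  z : Fin (suc (suc n)) → ℕ
  z zero                  = u
  z (Fin.suc zero)        = v
  z (Fin.suc (Fin.suc _)) = 0

odd≢2*u+[3+2*m]*w : ∀ m u w → 1 + 2 * m ≢ 2 * u + (3 + 2 * m) * w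
odd≢2*u+[3+2*m]*w m u zero    eq =
  ℕP.even≢odd u m (sym (trans eq (trans (cong (λ t → 2 * u + t) (ℕP.*-zeroʳ (3 + 2 * m))) (ℕP.+-identityʳ (2 * u)))))
odd≢2*u+[3+2*m]*w m u (suc w) eq = ℕP.<-irrefl eq (begin-strict
  1 + 2 * m                   <⟨ ℕP.m<n+m (1 + 2 * m) {2} z<s ⟩
  3 + 2 * m                   ≤⟨ ℕP.m≤m*n (3 + 2 * m) (suc w) ⟩
  (3 + 2 * m) * suc w         ≤⟨ ℕP.m≤n+m _ (2 * u) ⟩
  2 * u + (3 + 2 * m) * suc w ∎)
  where open ℕP.≤-Reasoning

twoAnd-frobenius : ∀ {n} m → IsFrobenius (twoAnd {suc n} (3 + 2 * m)) (+ (1 + 2 * m))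
twoAnd-frobenius {n} m = nonRepresentable , representableAbove
  where
  b = 3 + 2 * m

  nonRepresentable : ¬ Representable (twoAnd {suc n} b) (+ (1 + 2 * m))
  nonRepresentable (z , eq) =
    odd≢2*u+[3+2*m]*w m (z zero) (sumᵛ (z ∘ Fin.suc)) (trans (ℤP.+-injective eq) (twoAnd-combination b z))

  representableAbove : ∀ c → + (1 + 2 * m) ℤ.< c → Representable (twoAnd {suc n} b) c
  representableAbove (+ c) (ℤ.+<+ F<c) with even⊎odd c
  ... | q , inj₁ refl = twoAnd-representable b q 0 (2 * q)
    (trans (cong (λ t → 2 * q + t) (ℕP.*-zeroʳ b)) (ℕP.+-identityʳ (2 * q)))
  ... | q , inj₂ refl with ℕP.m≤n⇒∃[o]m+o≡n (ℕP.*-cancelˡ-< 2 m q (ℕP.≤-pred F<c))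
  ...   | r , refl = twoAnd-representable b r 1 _
    (solve 2 (λ m r → con 2 :* r :+ (con 3 :+ con 2 :* m) :* con 1
                      := con 1 :+ con 2 :* (con 1 :+ m :+ r)) refl m r)

c^d*x^p<y^d*x^q : ∀ {c d p q x y} .{{_ : NonZero x}} → p < d → x ≤ 3 * y → (3 * c) ^ d < y →
  c ^ d * x ^ p < y ^ d * x ^ q
c^d*x^p<y^d*x^q {c} {d} {p} {q} {x} {y} p<d x≤3y 3c^d<y = begin-strict
  c ^ d * x ^ p           ≤⟨ ℕP.*-monoʳ-≤ (c ^ d) (ℕP.^-monoˡ-≤ p x≤3y) ⟩
  c ^ d * (3 * y) ^ p     ≡⟨ cong (c ^ d *_) (^-distribʳ-* 3 y p) ⟩
  c ^ d * (3 ^ p * y ^ p) ≤⟨ ℕP.*-monoʳ-≤ (c ^ d) (ℕP.*-monoˡ-≤ (y ^ p) (ℕP.^-monoʳ-≤ 3 (ℕP.<⇒≤ p<d))) ⟩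
  c ^ d * (3 ^ d * y ^ p) ≡⟨ solve 3 (λ a b c → a :* (b :* c) := b :* a :* c) refl (c ^ d) (3 ^ d) (y ^ p) ⟩
  3 ^ d * c ^ d * y ^ p   ≡⟨ cong (_* y ^ p) (^-distribʳ-* 3 c d) ⟨
  (3 * c) ^ d * y ^ p     <⟨ ℕP.*-monoˡ-< (y ^ p) 3c^d<y ⟩
  y ^ suc p               ≤⟨ ℕP.^-monoʳ-≤ y p<d ⟩
  y ^ d                   ≤⟨ ℕP.m≤m*n (y ^ d) (x ^ q) ⟩
  y ^ d * x ^ q           ∎
  where
  open ℕP.≤-Reasoning
  instance
    y≢0 : NonZero y
    y≢0 = >-nonZero (ℕP.≤-<-trans z≤n 3c^d<y)
    y^p≢0 : NonZero (y ^ p)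
    y^p≢0 = ℕP.m^n≢0 y p
    x^q≢0 : NonZero (x ^ q)
    x^q≢0 = ℕP.m^n≢0 x q

toℚ : ℕ → ℚ
toℚ n = + n / 1

toℚ-mkℚ : ∀ n → toℚ n ≡ mkℚ (+ n) 0 (Coprime.sym (1-coprimeTo n))
toℚ-mkℚ n = ℚP.normalize-coprime (Coprime.sym (1-coprimeTo n))

toℚ-nonNeg : ∀ n → ℚ.NonNegative (toℚ n)
toℚ-nonNeg n rewrite toℚ-mkℚ n = _

toℚ-* : ∀ m n → toℚ (m * n) ≡ toℚ m ℚ.* toℚ n
toℚ-* m n rewrite toℚ-mkℚ m | toℚ-mkℚ n | sym (ℤP.pos-* m n) = refl

toℚ-^ : ∀ m k → toℚ (m ^ k) ≡ toℚ m ^ℚ k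
toℚ-^ m zero    = refl
toℚ-^ m (suc k) = trans (toℚ-* m (m ^ k)) (cong (toℚ m ℚ.*_) (toℚ-^ m k))

toℚ-mono-< : ∀ {m n} → m < n → toℚ m <ℚ toℚ n
toℚ-mono-< {m} {n} m<n rewrite toℚ-mkℚ m | toℚ-mkℚ n =
  ℚ.*<* (subst₂ ℤ._<_ (sym (ℤP.*-identityʳ (+ m))) (sym (ℤP.*-identityʳ (+ n))) (ℤ.+<+ m<n))

^ℚ-nonNeg : ∀ p .{{_ : ℚ.NonNegative p}} k → ℚ.NonNegative (p ^ℚ k)
^ℚ-nonNeg p zero    = _
^ℚ-nonNeg p (suc k) = ℚP.nonNeg*nonNeg⇒nonNeg p (p ^ℚ k) {{^ℚ-nonNeg p k}}

^ℚ-monoˡ-≤ : ∀ {p q} .{{_ : ℚ.NonNegative p}} → p ℚ.≤ q → ∀ k → p ^ℚ k ℚ.≤ q ^ℚ k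
^ℚ-monoˡ-≤         p≤q zero    = ℚP.≤-refl
^ℚ-monoˡ-≤ {p} {q} p≤q (suc k) = ℚP.≤-trans
  (ℚP.*-monoʳ-≤-nonNeg (p ^ℚ k) {{^ℚ-nonNeg p k}} p≤q)
  (ℚP.*-monoˡ-≤-nonNeg q {{ℚ.nonNegative (ℚP.≤-trans (ℚP.nonNegative⁻¹ p) p≤q)}} (^ℚ-monoˡ-≤ p≤q k))

≤-toℚ∣↥∣ : ∀ C → 0ℚ <ℚ C → C ℚ.≤ toℚ ℤ.∣ ℚ.↥ C ∣
≤-toℚ∣↥∣ (mkℚ (+ c) _ _) _ rewrite toℚ-mkℚ c =
  ℚ.*≤* (ℤP.*-monoˡ-≤-nonNeg (+ c) (ℤ.+≤+ (s≤s z≤n)))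
≤-toℚ∣↥∣ (mkℚ ℤ.-[1+ _ ] _ _) (ℚ.*<* ())

numerator⁺<denominator : ∀ s → s <ℚ 1ℚ → posPart (ℚ.numerator s) < ℚ.denominatorℕ s
numerator⁺<denominator (mkℚ (+ n) d _) (ℚ.*<* n<d)
  with subst₂ ℤ._<_ (ℤP.*-identityʳ (+ n)) (ℤP.*-identityˡ (+ suc d)) n<d
... | ℤ.+<+ n<d′ = n<d′
numerator⁺<denominator (mkℚ ℤ.-[1+ _ ] _ _) _ = z<s

¬LeCPow : ∀ {c x y} C s → 0ℚ <ℚ C → C ℚ.≤ toℚ c → 0 < y →
  c ^ ℚ.denominatorℕ s * x ^ posPart (ℚ.numerator s) < y ^ ℚ.denominatorℕ s * x ^ negPart (ℚ.numerator s) →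
  ¬ LeCPow (toℚ y) C (toℚ x) s
¬LeCPow {c} {x} {y} C s 0<C C≤c 0<y gap = [ y≰0 , rhs≰lhs ]
  where
  d = ℚ.denominatorℕ s
  p⁺ = posPart (ℚ.numerator s)
  p⁻ = negPart (ℚ.numerator s)
  instance
    x≥0 : ℚ.NonNegative (toℚ x)
    x≥0 = toℚ-nonNeg x
    C≥0 : ℚ.NonNegative C
    C≥0 = ℚ.nonNegative (ℚP.<⇒≤ 0<C)

  y≰0 : ¬ toℚ y ℚ.≤ 0ℚ
  y≰0 y≤0 = ℚP.<-irrefl refl (ℚP.<-≤-trans (toℚ-mono-< 0<y) y≤0)

  toℚ-^*^ : ∀ a b k l → toℚ (a ^ k * b ^ l) ≡ toℚ a ^ℚ k ℚ.* toℚ b ^ℚ l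
  toℚ-^*^ a b k l = trans (toℚ-* (a ^ k) (b ^ l)) (cong₂ ℚ._*_ (toℚ-^ a k) (toℚ-^ b l))

  rhs≰lhs : ¬ toℚ y ^ℚ d ℚ.* toℚ x ^ℚ p⁻ ℚ.≤ C ^ℚ d ℚ.* toℚ x ^ℚ p⁺
  rhs≰lhs le = ℚP.<-irrefl refl (ℚP.<-≤-trans (begin-strict
    C ^ℚ d ℚ.* toℚ x ^ℚ p⁺      ≤⟨ ℚP.*-monoʳ-≤-nonNeg (toℚ x ^ℚ p⁺) {{^ℚ-nonNeg (toℚ x) p⁺}} (^ℚ-monoˡ-≤ C≤c d) ⟩
    toℚ c ^ℚ d ℚ.* toℚ x ^ℚ p⁺  ≡⟨ toℚ-^*^ c x d p⁺ ⟨
    toℚ (c ^ d * x ^ p⁺)        <⟨ toℚ-mono-< gap ⟩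
    toℚ (y ^ d * x ^ p⁻)        ≡⟨ toℚ-^*^ y x d p⁻ ⟩
    toℚ y ^ℚ d ℚ.* toℚ x ^ℚ p⁻  ∎) le)
    where open ℚP.≤-Reasoning

1-ε<1 : ∀ ε → 0ℚ <ℚ ε → 1ℚ - ε <ℚ 1ℚ
1-ε<1 ε 0<ε = ℚP.+-monoʳ-< 1ℚ (ℚP.neg-antimono-< 0<ε)

2[3+2m]≤3[1+2m] : ∀ r → 2 * (3 + 2 * (2 + r)) ≤ 3 * (1 + 2 * (2 + r))
2[3+2m]≤3[1+2m] r = subst (2 * (3 + 2 * (2 + r)) ≤_)
  (solve 1 (λ r → con 2 :* (con 3 :+ con 2 :* (con 2 :+ r)) :+ (con 1 :+ con 2 :* r)
                  := con 3 :* (con 1 :+ con 2 :* (con 2 :+ r))) refl r)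
  (ℕP.m≤m+n _ (1 + 2 * r))

theorem1 : (k : ℕ) → 1 ≤ k → (ε : ℚ) → 0ℚ <ℚ ε → (C : ℚ) → 0ℚ <ℚ C →
    ¬ ((a : Fin (suc k) → ℕ) → (∀ i → 0 < a i) → gcdᵛ a ≡ 1 →
       (∀ (i j : Fin (suc k)) → i ≤ᶠ j → a i ≤ a j) →
       (f : ℤ) → IsFrobenius a f →
       LeCPow (f / 1) C ((+ (a zero * a (fromℕ k))) / 1) (1ℚ - ε))
theorem1 (suc k) _ ε 0<ε C 0<C bound =
  ¬LeCPow {c = c} C s 0<C (≤-toℚ∣↥∣ C 0<C) z<s gap
    (bound (twoAnd (3 + 2 * m)) (twoAnd-pos z<s) (twoAnd-gcd {k} m) (twoAnd-mono (s≤s (s≤s z≤n)))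
           (+ (1 + 2 * m)) (twoAnd-frobenius m))
  where
  s = 1ℚ - ε
  c = ℤ.∣ ℚ.↥ C ∣
  d = ℚ.denominatorℕ s
  p = ℚ.numerator s
  K = (3 * c) ^ d
  m = 2 + K
  gap : c ^ d * (2 * (3 + 2 * m)) ^ posPart p < (1 + 2 * m) ^ d * (2 * (3 + 2 * m)) ^ negPart p
  gap = c^d*x^p<y^d*x^q {c = c} {q = negPart p} {y = 1 + 2 * m} (numerator⁺<denominator s (1-ε<1 ε 0<ε)) (2[3+2m]≤3[1+2m] K)
                (s≤s (ℕP.≤-trans (ℕP.m≤n+m K 2) (ℕP.m≤m+n m _)))
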